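{- Let $P$, $Q$ be CP terms. If $P\Longrightarrow Q$ in CP, then $[\![P]\!]\Longrightarrow[\![Q]\!]$ in HCP.
   Context: CP terms: $P,Q,R ::= x\leftrightarrow y \mid \nu x(P\parallel Q)$ (cut; $x$ bound in $P$ and $Q$) $\mid x[y](P\parallel Q)$ (output; $y$ bound in $P$, $x$ continues in $Q$) $\mid x(y).P$ ($y$ bound in $P$) $\mid x[].0 \mid x().P \mid x\triangleleft\mathrm{inl}.P\mid x\triangleleft\mathrm{inr}.P\mid x\triangleright\{\mathrm{inl}:P;\mathrm{inr}:Q\}\mid x\triangleright\{\}$. CP structural congruence $\equiv$: smallest congruence containing $x\leftrightarrow y\equiv y\leftrightarrow x$; $\nu x(P\parallel Q)\equiv \nu x(Q\parallel P)$; $\nu x(P\parallel \nu y(Q\parallel R))\equiv \nu y(\nu x(P\parallel Q)\parallel R)$ if $x$ not free in $R$ and $y$ not free in $P$. CP reduction $\Longrightarrow$: smallest relation closed under $\nu x(w\leftrightarrow x\parallel P)\Longrightarrow P\{w/x\}$; $\nu x(x[y](P\parallel Q)\parallel x(y).R)\Longrightarrow \nu y(P\parallel \nu x(Q\parallel R))$; $\nu x(x[].0\parallel x().P)\Longrightarrow P$; $\nu x(x\triangleleft\mathrm{inl}.P\parallel x\triangleright\{\mathrm{inl}:Q;\mathrm{inr}:R\})\Longrightarrow \nu x(P\parallel Q)$; $\nu x(x\triangleleft\mathrm{inr}.P\parallel x\triangleright\{\mathrm{inl}:Q;\mathrm{inr}:R\})\Longrightarrow \nu x(P\parallel R)$;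 if $P\Longrightarrow P'$ then $\nu x(P\parallel Q)\Longrightarrow \nu x(P'\parallel Q)$; if $P\equiv Q\Longrightarrow Q'\equiv P'$ then $P\Longrightarrow P'$. HCP terms: $P,Q,R ::= x\leftrightarrow y \mid 0 \mid (\nu x)P$ (binds $x$) $\mid (P \mid Q) \mid x[y].P$ ($y$ bound in $P$) $\mid x(y).P$ ($y$ bound in $P$) $\mid x[].P \mid x().P \mid x\triangleleft \mathrm{inl}.P \mid x\triangleleft\mathrm{inr}.P \mid x\triangleright\{\mathrm{inl}:P;\mathrm{inr}:Q\} \mid x\triangleright\{\}$. HCP structural congruence $\equiv$: smallest congruence containing $x\leftrightarrow y\equiv y\leftrightarrow x$; $(P\mid 0)\equiv P$; $(P\mid Q)\equiv(Q\mid P)$; $(P\mid(Q\mid R))\equiv((P\mid Q)\mid R)$; $(\nu x)(\nu y)P\equiv(\nu y)(\nu x)P$; $(\nu x)(P\mid Q)\equiv (P\mid(\nu x)Q)$ if $x$ not free in $P$. HCP reduction $\Longrightarrow$: smallest relation closed under $(\nu x)(w\leftrightarrow x \mid P)\Longrightarrow P\{w/x\}$; $(\nu x)(x[y].P \mid x(y).R) \Longrightarrow (\nu x)(\nu y)(P\mid R)$; $(\nu x)(x[].P\mid x().Q)\Longrightarrow (P\mid Q)$; $(\nu x)(x\triangleleft\mathrm{inl}.P\mid x\triangleright\{\mathrm{inl}:Q;\mathrm{inr}:R\})\Longrightarrow(\nu x)(P\mid Q)$; $(\nu x)(x\triangleleft\mathrm{inr}.P\mid x\triangleright\{\mathrm{inl}:Q;\mathrm{inr}:R\})\Longrightarrow(\nu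 x)(P\mid R)$; if $P\Longrightarrow P'$ then $(\nu x)P\Longrightarrow(\nu x)P'$ and $(P\mid Q)\Longrightarrow(P'\mid Q)$; if $P\equiv Q\Longrightarrow Q'\equiv P'$ then $P\Longrightarrow P'$. The translation $[\![\cdot]\!]$ from CP to HCP terms: $[\![x\leftrightarrow y]\!]=x\leftrightarrow y$; $[\![\nu x(P\parallel Q)]\!]=(\nu x)([\![P]\!]\mid[\![Q]\!])$; $[\![x[y](P\parallel Q)]\!]=x[y].([\![P]\!]\mid[\![Q]\!])$; $[\![x(y).P]\!]=x(y).[\![P]\!]$; $[\![x[].0]\!]=x[].0$; $[\![x().P]\!]=x().[\![P]\!]$; $[\![x\triangleleft\mathrm{inl}.P]\!]=x\triangleleft\mathrm{inl}.[\![P]\!]$; $[\![x\triangleleft\mathrm{inr}.P]\!]=x\triangleleft\mathrm{inr}.[\![P]\!]$; $[\![x\triangleright\{\mathrm{inl}:P;\mathrm{inr}:Q\}]\!]=x\triangleright\{\mathrm{inl}:[\![P]\!];\mathrm{inr}:[\![Q]\!]\}$; $[\![x\triangleright\{\}]\!]=x\triangleright\{\}$. -}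

module Defs where

open import Data.Nat using (ℕ; zero; suc)
open import Data.Fin using (Fin; zero; suc)

-- Well-scoped de Bruijn syntax: a term of type CP n / HCP n has its free
-- names among Fin n.  A binder introduces the new name as `zero` and shifts
-- all other names by one.  Alpha-equivalent terms are identical, and the
-- side conditions "x not free in R" are expressed by R being a weakening.

Ren : ℕ → ℕ → Set
Ren m n = Fin m → Fin n

ext : ∀ {m n} → Ren m n → Ren (suc m) (suc n)
ext ρ zero    = zero
ext ρ (suc i) = suc (ρ i)

thin1 : ∀ {n} → Ren (suc n) (suc (suc n))
thin1 = ext suc

swap : ∀ {n} → Ren (suc (suc n)) (suc (suc n))
swap zero          = suc zero
swap (suc zero)    = zero
swap (suc (suc i)) = suc (suc i)

sub0 : ∀ {n} → Fin n → Ren (suc n) n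
sub0 w zero    = w
sub0 w (suc i) = i

data CP (n : ℕ) : Set where
  fwd    : Fin n → Fin n → CP n
  cut    : CP (suc n) → CP (suc n) → CP n
  send   : Fin n → CP (suc n) → CP n → CP n     -- x[y](P ∥ Q), y bound in P only
  recv   : Fin n → CP (suc n) → CP n
  close  : Fin n → CP n
  wait   : Fin n → CP n → CP n
  selL   : Fin n → CP n → CP n
  selR   : Fin n → CP n → CP n
  offer  : Fin n → CP n → CP n → CP n
  absurd : Fin n → CP n

renCP : ∀ {m n} → Ren m n → CP m → CP n
renCP ρ (fwd x y)     = fwd (ρ x) (ρ y)
renCP ρ (cut P Q)     = cut (renCP (ext ρ) P) (renCP (ext ρ) Q)
renCP ρ (send x P Q)  = send (ρ x) (renCP (ext ρ) P) (renCP ρ Q)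
renCP ρ (recv x P)    = recv (ρ x) (renCP (ext ρ) P)
renCP ρ (close x)     = close (ρ x)
renCP ρ (wait x P)    = wait (ρ x) (renCP ρ P)
renCP ρ (selL x P)    = selL (ρ x) (renCP ρ P)
renCP ρ (selR x P)    = selR (ρ x) (renCP ρ P)
renCP ρ (offer x P Q) = offer (ρ x) (renCP ρ P) (renCP ρ Q)
renCP ρ (absurd x)    = absurd (ρ x)

infix 4 _≡CP_
data _≡CP_ {n : ℕ} : CP n → CP n → Set where
  refl'     : ∀ {P} → P ≡CP P
  sym'      : ∀ {P Q} → P ≡CP Q → Q ≡CP P
  trans'    : ∀ {P Q R} → P ≡CP Q → Q ≡CP R → P ≡CP R
  fwd-comm  : ∀ {x y} → fwd x y ≡CP fwd y x
  cut-comm  : ∀ {P Q} → cut P Q ≡CP cut Q P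
  -- ν x (P ∥ ν y (Q ∥ R)) ≡ ν y (ν x (P ∥ Q) ∥ R), x ∉ fv R, y ∉ fv P
  cut-assoc : ∀ {P : CP (suc n)} {Q : CP (suc (suc n))} {R : CP (suc n)} →
              cut P (cut Q (renCP thin1 R))
                ≡CP cut (cut (renCP thin1 P) (renCP swap Q)) R
  cut-cong   : ∀ {P P' Q Q'} → P ≡CP P' → Q ≡CP Q' → cut P Q ≡CP cut P' Q'
  send-cong  : ∀ {x P P' Q Q'} → P ≡CP P' → Q ≡CP Q' → send x P Q ≡CP send x P' Q'
  recv-cong  : ∀ {x P P'} → P ≡CP P' → recv x P ≡CP recv x P'
  wait-cong  : ∀ {x P P'} → P ≡CP P' → wait x P ≡CP wait x P'
  selL-cong  : ∀ {x P P'} → P ≡CP P' → selL x P ≡CP selL x P'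
  selR-cong  : ∀ {x P P'} → P ≡CP P' → selR x P ≡CP selR x P'
  offer-cong : ∀ {x P P' Q Q'} → P ≡CP P' → Q ≡CP Q' → offer x P Q ≡CP offer x P' Q'

infix 4 _⟹CP_
data _⟹CP_ {n : ℕ} : CP n → CP n → Set where
  β-fwd   : ∀ {w : Fin n} {P} → cut (fwd (suc w) zero) P ⟹CP renCP (sub0 w) P
  -- ν x (x[y](P ∥ Q) ∥ x(y).R) ⟹ ν y (P ∥ ν x (Q ∥ R))
  β-send  : ∀ {P : CP (suc n)} {Q : CP (suc n)} {R : CP (suc (suc n))} →
            cut (send zero (renCP thin1 P) Q) (recv zero R)
              ⟹CP cut P (cut (renCP thin1 Q) (renCP swap R))
  β-close : ∀ {P : CP n} → cut (close zero) (wait zero (renCP suc P)) ⟹CP P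
  β-inl   : ∀ {P Q R : CP (suc n)} → cut (selL zero P) (offer zero Q R) ⟹CP cut P Q
  β-inr   : ∀ {P Q R : CP (suc n)} → cut (selR zero P) (offer zero Q R) ⟹CP cut P R
  cut-red : ∀ {P P' Q : CP (suc n)} → P ⟹CP P' → cut P Q ⟹CP cut P' Q
  struct  : ∀ {P Q Q' P'} → P ≡CP Q → Q ⟹CP Q' → Q' ≡CP P' → P ⟹CP P'

data HCP (n : ℕ) : Set where
  hfwd    : Fin n → Fin n → HCP n
  hnil    : HCP n
  hnu     : HCP (suc n) → HCP n
  hpar    : HCP n → HCP n → HCP n
  hsend   : Fin n → HCP (suc n) → HCP n
  hrecv   : Fin n → HCP (suc n) → HCP n
  hclose  : Fin n → HCP n → HCP n
  hwait   : Fin n → HCP n → HCP n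
  hselL   : Fin n → HCP n → HCP n
  hselR   : Fin n → HCP n → HCP n
  hoffer  : Fin n → HCP n → HCP n → HCP n
  habsurd : Fin n → HCP n

renH : ∀ {m n} → Ren m n → HCP m → HCP n
renH ρ (hfwd x y)     = hfwd (ρ x) (ρ y)
renH ρ hnil           = hnil
renH ρ (hnu P)        = hnu (renH (ext ρ) P)
renH ρ (hpar P Q)     = hpar (renH ρ P) (renH ρ Q)
renH ρ (hsend x P)    = hsend (ρ x) (renH (ext ρ) P)
renH ρ (hrecv x P)    = hrecv (ρ x) (renH (ext ρ) P)
renH ρ (hclose x P)   = hclose (ρ x) (renH ρ P)
renH ρ (hwait x P)    = hwait (ρ x) (renH ρ P)
renH ρ (hselL x P)    = hselL (ρ x) (renH ρ P)
renH ρ (hselR x P)    = hselR (ρ x) (renH ρ P)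
renH ρ (hoffer x P Q) = hoffer (ρ x) (renH ρ P) (renH ρ Q)
renH ρ (habsurd x)    = habsurd (ρ x)

infix 4 _≡H_
data _≡H_ {n : ℕ} : HCP n → HCP n → Set where
  refl'     : ∀ {P} → P ≡H P
  sym'      : ∀ {P Q} → P ≡H Q → Q ≡H P
  trans'    : ∀ {P Q R} → P ≡H Q → Q ≡H R → P ≡H R
  fwd-comm  : ∀ {x y} → hfwd x y ≡H hfwd y x
  par-nil   : ∀ {P} → hpar P hnil ≡H P
  par-comm  : ∀ {P Q} → hpar P Q ≡H hpar Q P
  par-assoc : ∀ {P Q R} → hpar P (hpar Q R) ≡H hpar (hpar P Q) R
  nu-swap   : ∀ {P : HCP (suc (suc n))} → hnu (hnu P) ≡H hnu (hnu (renH swap P))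
  nu-extr   : ∀ {P : HCP n} {Q : HCP (suc n)} → hnu (hpar (renH suc P) Q) ≡H hpar P (hnu Q)
  nu-cong    : ∀ {P P'} → P ≡H P' → hnu P ≡H hnu P'
  par-cong   : ∀ {P P' Q Q'} → P ≡H P' → Q ≡H Q' → hpar P Q ≡H hpar P' Q'
  send-cong  : ∀ {x P P'} → P ≡H P' → hsend x P ≡H hsend x P'
  recv-cong  : ∀ {x P P'} → P ≡H P' → hrecv x P ≡H hrecv x P'
  close-cong : ∀ {x P P'} → P ≡H P' → hclose x P ≡H hclose x P'
  wait-cong  : ∀ {x P P'} → P ≡H P' → hwait x P ≡H hwait x P'
  selL-cong  : ∀ {x P P'} → P ≡H P' → hselL x P ≡H hselL x P'
  selR-cong  : ∀ {x P P'} → P ≡H P' → hselR x P ≡H hselR x P'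
  offer-cong : ∀ {x P P' Q Q'} → P ≡H P' → Q ≡H Q' → hoffer x P Q ≡H hoffer x P' Q'

infix 4 _⟹H_
data _⟹H_ {n : ℕ} : HCP n → HCP n → Set where
  β-fwd   : ∀ {w : Fin n} {P} → hnu (hpar (hfwd (suc w) zero) P) ⟹H renH (sub0 w) P
  β-send  : ∀ {P R : HCP (suc (suc n))} →
            hnu (hpar (hsend zero P) (hrecv zero R)) ⟹H hnu (hnu (hpar P R))
  β-close : ∀ {P Q : HCP n} →
            hnu (hpar (hclose zero (renH suc P)) (hwait zero (renH suc Q))) ⟹H hpar P Q
  β-inl   : ∀ {P Q R : HCP (suc n)} →
            hnu (hpar (hselL zero P) (hoffer zero Q R)) ⟹H hnu (hpar P Q)
  β-inr   : ∀ {P Q R : HCP (suc n)} →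
            hnu (hpar (hselR zero P) (hoffer zero Q R)) ⟹H hnu (hpar P R)
  nu-red  : ∀ {P P' : HCP (suc n)} → P ⟹H P' → hnu P ⟹H hnu P'
  par-red : ∀ {P P' Q : HCP n} → P ⟹H P' → hpar P Q ⟹H hpar P' Q
  struct  : ∀ {P Q Q' P'} → P ≡H Q → Q ⟹H Q' → Q' ≡H P' → P ⟹H P'

⟦_⟧ : ∀ {n} → CP n → HCP n
⟦ fwd x y ⟧     = hfwd x y
⟦ cut P Q ⟧     = hnu (hpar ⟦ P ⟧ ⟦ Q ⟧)
-- y is bound in the whole of [[P]] | [[Q]]; Q does not mention y
⟦ send x P Q ⟧  = hsend x (hpar ⟦ P ⟧ (renH suc ⟦ Q ⟧))
⟦ recv x P ⟧    = hrecv x ⟦ P ⟧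
⟦ close x ⟧     = hclose x hnil
⟦ wait x P ⟧    = hwait x ⟦ P ⟧
⟦ selL x P ⟧    = hselL x ⟦ P ⟧
⟦ selR x P ⟧    = hselR x ⟦ P ⟧
⟦ offer x P Q ⟧ = hoffer x ⟦ P ⟧ ⟦ Q ⟧
⟦ absurd x ⟧    = habsurd x

module Submission where

-- The proof is by induction on the CP reduction: cut congruence maps to the
-- HCP rules for ν and |, the structural rule needs that ⟦_⟧ maps CP
-- congruence into HCP congruence, and each CP axiom maps to the matching
-- HCP axiom up to HCP congruence and de Bruijn renaming bookkeeping.

open import Data.Nat using (ℕ; suc)
open import Data.Fin using (Fin; zero; suc)
open import Level using (0ℓ)
open import Relation.Binary.Bundles using (Setoid)
open import Relation.Binary.PropositionalEquality using (_≡_; refl; sym; trans; cong; cong₂)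
import Relation.Binary.Reasoning.Setoid as SetoidReasoning
open import Function using (_$_)
open import Defs

≡H-setoid : ℕ → Setoid 0ℓ 0ℓ
≡H-setoid n = record
  { Carrier       = HCP n
  ; _≈_           = _≡H_
  ; isEquivalence = record { refl = refl' ; sym = sym' ; trans = trans' }
  }

module ≡H-Reasoning {n : ℕ} = SetoidReasoning (≡H-setoid n)

≡⇒≡H : ∀ {n} {P Q : HCP n} → P ≡ Q → P ≡H Q
≡⇒≡H refl = refl'

ext-fuse : ∀ {a b c} {ρ : Ren b c} {σ : Ren a b} {τ : Ren a c} →
           (∀ i → ρ (σ i) ≡ τ i) → ∀ i → ext ρ (ext σ i) ≡ ext τ i
ext-fuse e zero    = refl
ext-fuse e (suc i) = cong suc (e i)

renH-fuse : ∀ {a b c} {ρ : Ren b c} {σ : Ren a b} {τ : Ren a c} →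
            (∀ i → ρ (σ i) ≡ τ i) → ∀ P → renH ρ (renH σ P) ≡ renH τ P
renH-fuse e (hfwd x y)     = cong₂ hfwd (e x) (e y)
renH-fuse e hnil           = refl
renH-fuse e (hnu P)        = cong hnu (renH-fuse (ext-fuse e) P)
renH-fuse e (hpar P Q)     = cong₂ hpar (renH-fuse e P) (renH-fuse e Q)
renH-fuse e (hsend x P)    = cong₂ hsend (e x) (renH-fuse (ext-fuse e) P)
renH-fuse e (hrecv x P)    = cong₂ hrecv (e x) (renH-fuse (ext-fuse e) P)
renH-fuse e (hclose x P)   = cong₂ hclose (e x) (renH-fuse e P)
renH-fuse e (hwait x P)    = cong₂ hwait (e x) (renH-fuse e P)
renH-fuse e (hselL x P)    = cong₂ hselL (e x) (renH-fuse e P)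
renH-fuse e (hselR x P)    = cong₂ hselR (e x) (renH-fuse e P)
renH-fuse e (hoffer x P Q) = cong₂ _$_ (cong₂ hoffer (e x) (renH-fuse e P)) (renH-fuse e Q)
renH-fuse e (habsurd x)    = cong habsurd (e x)

renH-square : ∀ {a b b' c} {ρ : Ren b c} {σ : Ren a b} {ρ' : Ren b' c} {σ' : Ren a b'} →
              (∀ i → ρ (σ i) ≡ ρ' (σ' i)) → ∀ P → renH ρ (renH σ P) ≡ renH ρ' (renH σ' P)
renH-square e P = trans (renH-fuse e P) (sym (renH-fuse (λ _ → refl) P))

renH-ext-suc : ∀ {m n} (ρ : Ren m n) P → renH (ext ρ) (renH suc P) ≡ renH suc (renH ρ P)
renH-ext-suc ρ = renH-square (λ _ → refl)

swap-suc : ∀ {n} (P : HCP (suc n)) → renH swap (renH suc P) ≡ renH thin1 P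
swap-suc = renH-fuse pointwise
  where
  pointwise : ∀ {n} (i : Fin (suc n)) → swap (suc i) ≡ thin1 i
  pointwise zero    = refl
  pointwise (suc i) = refl

swap-thin1 : ∀ {n} (P : HCP (suc n)) → renH swap (renH thin1 P) ≡ renH suc P
swap-thin1 = renH-fuse pointwise
  where
  pointwise : ∀ {n} (i : Fin (suc n)) → swap (thin1 i) ≡ suc i
  pointwise zero    = refl
  pointwise (suc i) = refl

swap-ext² : ∀ {m n} (ρ : Ren m n) P →
            renH swap (renH (ext (ext ρ)) P) ≡ renH (ext (ext ρ)) (renH swap P)
swap-ext² ρ = renH-square pointwise
  where
  pointwise : ∀ i → swap (ext (ext ρ) i) ≡ ext (ext ρ) (swap i)
  pointwise zero          = refl
  pointwise (suc zero)    = refl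
  pointwise (suc (suc i)) = refl

-- HCP structural congruence is stable under renaming; needed because the
-- translation of an output weakens its continuation.
renH-≡H : ∀ {m n} (ρ : Ren m n) {P Q : HCP m} → P ≡H Q → renH ρ P ≡H renH ρ Q
renH-≡H ρ refl'            = refl'
renH-≡H ρ (sym' e)         = sym' (renH-≡H ρ e)
renH-≡H ρ (trans' e f)     = trans' (renH-≡H ρ e) (renH-≡H ρ f)
renH-≡H ρ fwd-comm         = fwd-comm
renH-≡H ρ par-nil          = par-nil
renH-≡H ρ par-comm         = par-comm
renH-≡H ρ par-assoc        = par-assoc
renH-≡H ρ (nu-swap {P = P}) =
  trans' nu-swap (nu-cong (nu-cong (≡⇒≡H (swap-ext² ρ P))))
renH-≡H ρ (nu-extr {P = P}) =
  trans' (nu-cong (par-cong (≡⇒≡H (renH-ext-suc ρ P)) refl')) nu-extr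
renH-≡H ρ (nu-cong e)      = nu-cong (renH-≡H (ext ρ) e)
renH-≡H ρ (par-cong e f)   = par-cong (renH-≡H ρ e) (renH-≡H ρ f)
renH-≡H ρ (send-cong e)    = send-cong (renH-≡H (ext ρ) e)
renH-≡H ρ (recv-cong e)    = recv-cong (renH-≡H (ext ρ) e)
renH-≡H ρ (close-cong e)   = close-cong (renH-≡H ρ e)
renH-≡H ρ (wait-cong e)    = wait-cong (renH-≡H ρ e)
renH-≡H ρ (selL-cong e)    = selL-cong (renH-≡H ρ e)
renH-≡H ρ (selR-cong e)    = selR-cong (renH-≡H ρ e)
renH-≡H ρ (offer-cong e f) = offer-cong (renH-≡H ρ e) (renH-≡H ρ f)

translate-ren : ∀ {m n} (ρ : Ren m n) P → ⟦ renCP ρ P ⟧ ≡ renH ρ ⟦ P ⟧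
translate-ren ρ (fwd x y)     = refl
translate-ren ρ (cut P Q)     = cong hnu (cong₂ hpar (translate-ren (ext ρ) P) (translate-ren (ext ρ) Q))
translate-ren ρ (send x P Q)  = cong (hsend (ρ x)) (cong₂ hpar (translate-ren (ext ρ) P)
                                  (trans (cong (renH suc) (translate-ren ρ Q)) (sym (renH-ext-suc ρ ⟦ Q ⟧))))
translate-ren ρ (recv x P)    = cong (hrecv (ρ x)) (translate-ren (ext ρ) P)
translate-ren ρ (close x)     = refl
translate-ren ρ (wait x P)    = cong (hwait (ρ x)) (translate-ren ρ P)
translate-ren ρ (selL x P)    = cong (hselL (ρ x)) (translate-ren ρ P)
translate-ren ρ (selR x P)    = cong (hselR (ρ x)) (translate-ren ρ P)
translate-ren ρ (offer x P Q) = cong₂ (hoffer (ρ x)) (translate-ren ρ P) (translate-ren ρ Q)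
translate-ren ρ (absurd x)    = refl

-- Associativity of CP cuts is derived in HCP by extruding both restrictions
-- to the top, reassociating and exchanging them, and pulling them back in.
translate-cut-assoc : ∀ {n} (P : CP (suc n)) (Q : CP (suc (suc n))) (R : CP (suc n)) →
                      ⟦ cut P (cut Q (renCP thin1 R)) ⟧
                        ≡H ⟦ cut (cut (renCP thin1 P) (renCP swap Q)) R ⟧
translate-cut-assoc P Q R = begin
  hnu (hpar p (hnu (hpar q ⟦ renCP thin1 R ⟧)))
    ≈⟨ nu-cong nu-extr ⟨
  hnu (hnu (hpar (renH suc p) (hpar q ⟦ renCP thin1 R ⟧)))
    ≈⟨ nu-cong (nu-cong par-assoc) ⟩
  hnu (hnu (hpar (hpar (renH suc p) q) ⟦ renCP thin1 R ⟧))
    ≈⟨ nu-swap ⟩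
  hnu (hnu (hpar (hpar (renH swap (renH suc p)) (renH swap q)) (renH swap ⟦ renCP thin1 R ⟧)))
    ≡⟨ cong₂ (λ p' r' → hnu (hnu (hpar (hpar p' (renH swap q)) r')))
         (swap-suc p) (trans (cong (renH swap) (translate-ren thin1 R)) (swap-thin1 r)) ⟩
  hnu (hnu (hpar (hpar (renH thin1 p) (renH swap q)) (renH suc r)))
    ≈⟨ nu-cong (nu-cong par-comm) ⟩
  hnu (hnu (hpar (renH suc r) (hpar (renH thin1 p) (renH swap q))))
    ≈⟨ nu-cong nu-extr ⟩
  hnu (hpar r (hnu (hpar (renH thin1 p) (renH swap q))))
    ≈⟨ nu-cong par-comm ⟩
  hnu (hpar (hnu (hpar (renH thin1 p) (renH swap q))) r)
    ≡⟨ cong₂ (λ p' q' → hnu (hpar (hnu (hpar p' q')) r)) (translate-ren thin1 P) (translate-ren swap Q) ⟨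
  hnu (hpar (hnu (hpar ⟦ renCP thin1 P ⟧ ⟦ renCP swap Q ⟧)) r) ∎
  where
  open ≡H-Reasoning
  p = ⟦ P ⟧
  q = ⟦ Q ⟧
  r = ⟦ R ⟧

translate-≡ : ∀ {n} {P Q : CP n} → P ≡CP Q → ⟦ P ⟧ ≡H ⟦ Q ⟧
translate-≡ refl'                         = refl'
translate-≡ (sym' e)                      = sym' (translate-≡ e)
translate-≡ (trans' e f)                  = trans' (translate-≡ e) (translate-≡ f)
translate-≡ fwd-comm                      = fwd-comm
translate-≡ cut-comm                      = nu-cong par-comm
translate-≡ (cut-assoc {P = P} {Q} {R})   = translate-cut-assoc P Q R
translate-≡ (cut-cong e f)                = nu-cong (par-cong (translate-≡ e) (translate-≡ f))
translate-≡ (send-cong e f)               = send-cong (par-cong (translate-≡ e) (renH-≡H suc (translate-≡ f)))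
translate-≡ (recv-cong e)                 = recv-cong (translate-≡ e)
translate-≡ (wait-cong e)                 = wait-cong (translate-≡ e)
translate-≡ (selL-cong e)                 = selL-cong (translate-≡ e)
translate-≡ (selR-cong e)                 = selR-cong (translate-≡ e)
translate-≡ (offer-cong e f)              = offer-cong (translate-≡ e) (translate-≡ f)

simulate-fwd : ∀ {n} (w : Fin n) (P : CP (suc n)) →
               ⟦ cut (fwd (suc w) zero) P ⟧ ⟹H ⟦ renCP (sub0 w) P ⟧
simulate-fwd w P = struct refl' β-fwd (≡⇒≡H (sym (translate-ren (sub0 w) P)))

-- Output/input: HCP binds both x and y around P | Q | R, and the CP result
-- ν y (P ∥ ν x (Q ∥ R)) is recovered by exchanging the two restrictions
-- and narrowing the scope of x to Q | R.
simulate-send : ∀ {n} (P Q : CP (suc n)) (R : CP (suc (suc n))) →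
                ⟦ cut (send zero (renCP thin1 P) Q) (recv zero R) ⟧
                  ⟹H ⟦ cut P (cut (renCP thin1 Q) (renCP swap R)) ⟧
simulate-send P Q R = struct refl' β-send scope-adjustment
  where
  open ≡H-Reasoning
  p = ⟦ P ⟧
  q = ⟦ Q ⟧
  r = ⟦ R ⟧
  scope-adjustment : hnu (hnu (hpar (hpar ⟦ renCP thin1 P ⟧ (renH suc q)) r))
                       ≡H ⟦ cut P (cut (renCP thin1 Q) (renCP swap R)) ⟧
  scope-adjustment = begin
    hnu (hnu (hpar (hpar ⟦ renCP thin1 P ⟧ (renH suc q)) r))
      ≈⟨ nu-swap ⟩
    hnu (hnu (hpar (hpar (renH swap ⟦ renCP thin1 P ⟧) (renH swap (renH suc q))) (renH swap r)))
      ≡⟨ cong₂ (λ p' q' → hnu (hnu (hpar (hpar p' q') (renH swap r))))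
           (trans (cong (renH swap) (translate-ren thin1 P)) (swap-thin1 p)) (swap-suc q) ⟩
    hnu (hnu (hpar (hpar (renH suc p) (renH thin1 q)) (renH swap r)))
      ≈⟨ nu-cong (nu-cong par-assoc) ⟨
    hnu (hnu (hpar (renH suc p) (hpar (renH thin1 q) (renH swap r))))
      ≈⟨ nu-cong nu-extr ⟩
    hnu (hpar p (hnu (hpar (renH thin1 q) (renH swap r))))
      ≡⟨ cong₂ (λ q' r' → hnu (hpar p (hnu (hpar q' r')))) (translate-ren thin1 Q) (translate-ren swap R) ⟨
    ⟦ cut P (cut (renCP thin1 Q) (renCP swap R)) ⟧ ∎

-- Close/wait: HCP leaves the empty continuation of the close in parallel,
-- which is absorbed by the unit law of composition.
simulate-close : ∀ {n} (P : CP n) → ⟦ cut (close zero) (wait zero (renCP suc P)) ⟧ ⟹H ⟦ P ⟧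
simulate-close P =
  struct (nu-cong (par-cong refl' (wait-cong (≡⇒≡H (translate-ren suc P)))))
         β-close
         (trans' par-comm par-nil)

theorem30 : ∀ {n : ℕ} {P Q : CP n} → P ⟹CP Q → ⟦ P ⟧ ⟹H ⟦ Q ⟧
theorem30 (β-fwd {w = w} {P = P})  = simulate-fwd w P
theorem30 (β-send {P = P} {Q} {R}) = simulate-send P Q R
theorem30 (β-close {P = P})        = simulate-close P
theorem30 β-inl                    = β-inl
theorem30 β-inr                    = β-inr
theorem30 (cut-red r)              = nu-red (par-red (theorem30 r))
theorem30 (struct e r f)           = struct (translate-≡ e) (theorem30 r) (translate-≡ f)
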